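{- Let $k\ge1$ and let $(G,\sigma)$ be a signed graph. If $|E(G)|<k^2-1$, then $\psi(G,\sigma)<2k-1$. If $|E(G)|<k^2$, then $\psi(G,\sigma)<2k$.
   Context: A signed graph $(G,\sigma)$ is a finite simple graph $G$ with a signature $\sigma:E(G)\to\{ -,+\}$. Switching a set $S\subseteq V(G)$ changes the sign of every edge with exactly one end in $S$; two signed graphs on the same underlying graph are equivalent if one is obtained from the other by switching some set of vertices. For $k\ge1$ let $M_k=\{ -n,\dots,-1,+1,\dots,+n\}$ if $k=2n$, and $M_k=\{ -n,\dots,-1,\pm0,+1,\dots,+n\}$ if $k=2n+1$, where $\pm0$ is a single colour with $-(\pm0)=\pm0$. A $k$-colouring of $(G,\sigma)$ is a map $\phi:V(G)\to M_k$. Let $K_k^*$ be the signed multigraph with vertex set $\{i\ge 0: +i\in M_k\}$ (vertex $0$ standing for colour $\pm0$ when $k$ is odd), in which every two distinct vertices are joined by exactly one positive and one negative edge, and every vertex $i\neq0$ carries exactly one negative loop. Given a $k$-colouring $\phi$, the reduced signed graph $R(G,\sigma,\phi)$ is obtained by (1) switching every vertex with a negative colour $-i$ and recolouring it $+i$; (2) identifying, for each $i$, all vertices of colour $+i$ (resp. $\pm0$) into a single vertex $i$ (resp. $0$), edges inside a class becoming loops; (3) keeping at most one positive and at most one negative edge (or loop) between any two vertices (or at any vertex). The colouring $\phi$ is complete if $R(G,\sigma,\phi)$ is exactly $K_k^*$. The achromatic number $\psi(G,\sigma)$ is the largest $k\ge1$ such that some signed graph equivalent to $(G,\sigma)$ admits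 a complete $k$-colouring. -}

module Defs where

open import Data.Nat using (ℕ; zero; suc; _+_; _*_; _∸_; _≤_; _<_; _%_)
open import Data.Bool using (Bool; true; false)
open import Data.Fin using (Fin)
import Data.Fin as F
open import Data.List using (List; length)
open import Data.List.Relation.Unary.All using (All)
open import Data.List.Relation.Unary.Unique.Propositional using (Unique)
open import Data.List.Membership.Propositional using (_∈_)
open import Data.Product using (Σ; ∃; _×_; _,_; proj₁; proj₂)
open import Data.Sum using (_⊎_)
open import Relation.Binary.PropositionalEquality using (_≡_; _≢_)
open import Relation.Nullary using (¬_)

data Sign : Set where
  pos neg : Sign

_·_ : Sign → Sign → Sign
pos · s = s
neg · pos = neg
neg · neg = pos

-- A finite simple graph on vertex set Fin n. Each edge {u,v} is stored
-- once, as the ordered pair (u , v) with u < v; no duplicates.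
record Graph : Set where
  field
    n       : ℕ
    E       : List (Fin n × Fin n)
    ordered : All (λ e → proj₁ e F.< proj₂ e) E
    unique  : Unique E

open Graph public

∣E∣ : Graph → ℕ
∣E∣ G = length (E G)

-- A signature: the sign of edge (u , v) ∈ E is σ u v (values off E irrelevant).
Signature : Graph → Set
Signature G = Fin (n G) → Fin (n G) → Sign

-- Vertices of K_k^* (= magnitudes of colours in M_k):
-- i with 1 ≤ i ≤ ⌊k/2⌋, and i = 0 exactly when k is odd.
VMag : ℕ → ℕ → Set
VMag k i = (1 ≤ i × 2 * i ≤ k) ⊎ (i ≡ 0 × k % 2 ≡ 1)

-- Colours of M_k: a sign and a magnitude; the colour ±0 is represented
-- uniquely as (pos , 0).
ValidColour : ℕ → Sign × ℕ → Set
ValidColour k (s , i) = (1 ≤ i × 2 * i ≤ k) ⊎ (i ≡ 0 × s ≡ pos × k % 2 ≡ 1)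

Colour : ℕ → Set
Colour k = Σ (Sign × ℕ) (ValidColour k)

sgn : ∀ {k} → Colour k → Sign
sgn ((s , _) , _) = s

mag : ∀ {k} → Colour k → ℕ
mag ((_ , i) , _) = i

swSign : Bool → Sign
swSign true  = neg
swSign false = pos

switch : (G : Graph) → Signature G → (Fin (n G) → Bool) → Signature G
switch G σ S u v = (σ u v · swSign (S u)) · swSign (S v)

Colouring : Graph → ℕ → Set
Colouring G k = Fin (n G) → Colour k

-- Sign of edge (u , v) after step (1) of the reduction (switching all
-- vertices with negative colours).
redSign : (G : Graph) → Signature G → ∀ {k} → Colouring G k →
          Fin (n G) → Fin (n G) → Sign
redSign G σ φ u v = (σ u v · sgn (φ u)) · sgn (φ v)

-- φ is complete for (G , σ): R(G,σ,φ) is exactly K_k^*.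
record Complete (G : Graph) (σ : Signature G) (k : ℕ) (φ : Colouring G k) : Set where
  field
    surj      : ∀ i → VMag k i → ∃ λ v → mag (φ v) ≡ i
    loopsOK   : ∀ u v → (u , v) ∈ E G → mag (φ u) ≡ mag (φ v) →
                mag (φ u) ≢ 0 × redSign G σ φ u v ≡ neg
    edgesAll  : ∀ i j → VMag k i → VMag k j → i < j → ∀ s →
                ∃ λ u → ∃ λ v → (u , v) ∈ E G ×
                  ((mag (φ u) ≡ i × mag (φ v) ≡ j) ⊎ (mag (φ u) ≡ j × mag (φ v) ≡ i)) ×
                  redSign G σ φ u v ≡ s
    loopsAll  : ∀ i → VMag k i → 1 ≤ i →
                ∃ λ u → ∃ λ v → (u , v) ∈ E G ×
                  mag (φ u) ≡ i × mag (φ v) ≡ i × redSign G σ φ u v ≡ neg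

HasCompleteColouring : (G : Graph) → Signature G → ℕ → Set
HasCompleteColouring G σ k =
  ∃ λ (S : Fin (n G) → Bool) → ∃ λ (φ : Colouring G k) → Complete G (switch G σ S) k φ

-- ψ(G,σ) < m : no k ≥ m admits a complete colouring of an equivalent signed graph
-- (ψ is the largest such k with k ≥ 1).
ψ-lt : (G : Graph) → Signature G → ℕ → Set
ψ-lt G σ m = ∀ k → m ≤ k → ¬ (HasCompleteColouring G σ k)

-- A complete k-colouring maps the edges of G onto the edges and loops of the
-- reduced graph K_k^*, so |E(G)| is at least the number of edges of K_k^*.
-- If k ≥ 2m then 1, …, m are vertices of K_k^*, spanning m negative loops and
-- 2·C(m,2) further edges: m² in total.  If k = 2m − 1 the vertices are
-- 0, …, m − 1 and there is no loop at 0: m² − 1 edges.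
module Submission where

open import Defs
open import Data.Nat using (ℕ; zero; suc; _+_; _*_; _∸_; _≤_; _<_; _⊓_; _⊔_; _%_; z≤n; s≤s; _≤?_)
open import Data.Nat.Properties
open import Data.Nat.DivMod using ([m+kn]%n≡m%n)
open import Data.Nat.Tactic.RingSolver using (solve-∀)
open import Data.Fin as F using (Fin)
open import Data.Fin.Properties using (injective⇒≤)
open import Data.List using (List; []; _∷_; _++_; length; map; lookup)
open import Data.List.Properties using (length-++; length-map)
open import Data.List.Relation.Unary.All as All using (All; []; _∷_)
open import Data.List.Relation.Unary.All.Properties using (++⁺)
open import Data.List.Relation.Unary.AllPairs using ([]; _∷_)
import Data.List.Relation.Unary.AllPairs.Properties as AllPairs
open import Data.List.Relation.Unary.Any using (index)
open import Data.List.Relation.Unary.Any.Properties using (lookup-index)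
open import Data.List.Relation.Unary.Unique.Propositional using (Unique)
open import Data.List.Membership.Propositional using (_∈_)
open import Data.List.Membership.Propositional.Properties using (∈-map⁺; ∈-lookup)
open import Data.List.Relation.Binary.Subset.Propositional using (_⊆_)
open import Data.Product using (_×_; _,_)
open import Data.Sum using (inj₁; inj₂)
open import Data.Empty using (⊥-elim)
open import Relation.Nullary using (yes; no)
open import Relation.Binary.PropositionalEquality

lookup-injective : ∀ {A : Set} {xs : List A} → Unique xs →
                   ∀ i j → lookup xs i ≡ lookup xs j → i ≡ j
lookup-injective (_   ∷ _)  F.zero    F.zero    _  = refl
lookup-injective (x∉ ∷ _)  F.zero    (F.suc j) eq = ⊥-elim (All.lookup x∉ (∈-lookup j) eq)
lookup-injective (x∉ ∷ _)  (F.suc i) F.zero    eq = ⊥-elim (All.lookup x∉ (∈-lookup i) (sym eq))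
lookup-injective (_   ∷ u) (F.suc i) (F.suc j) eq = cong F.suc (lookup-injective u i j eq)

Unique-⊆⇒length≤ : ∀ {A : Set} {xs ys : List A} → Unique xs → xs ⊆ ys →
                   length xs ≤ length ys
Unique-⊆⇒length≤ {xs = xs} {ys} u xs⊆ys = injective⇒≤ position-injective
  where
  position : Fin (length xs) → Fin (length ys)
  position i = index (xs⊆ys (∈-lookup i))

  lookup-position : ∀ i → lookup ys (position i) ≡ lookup xs i
  lookup-position i = sym (lookup-index (xs⊆ys (∈-lookup i)))

  position-injective : ∀ {i j} → position i ≡ position j → i ≡ j
  position-injective {i} {j} eq = lookup-injective u i j (begin
    lookup xs i             ≡⟨ lookup-position i ⟨
    lookup ys (position i)  ≡⟨ cong (lookup ys) eq ⟩
    lookup ys (position j)  ≡⟨ lookup-position j ⟩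
    lookup xs j             ∎)
    where open ≡-Reasoning

-- An edge of K_k^* as (lower magnitude , upper magnitude , sign); a loop has
-- equal magnitudes.
KEdge : Set
KEdge = ℕ × ℕ × Sign

lower upper : KEdge → ℕ
lower (i , _ , _) = i
upper (_ , j , _) = j

≢-by : (f : KEdge → ℕ) → ∀ {x y} → f x < f y → x ≢ y
≢-by f fx<fy x≡y = <⇒≢ fx<fy (cong f x≡y)

edgesBelow : ℕ → ℕ → ℕ → List KEdge
edgesBelow a zero    j = []
edgesBelow a (suc t) j = (a + t , j , pos) ∷ (a + t , j , neg) ∷ edgesBelow a t j

negLoopAt : ℕ → List KEdge
negLoopAt zero    = []
negLoopAt (suc j) = (suc j , suc j , neg) ∷ []

edgesOn : ℕ → ℕ → List KEdge
edgesOn a zero    = []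
edgesOn a (suc t) = edgesOn a t ++ (negLoopAt (a + t) ++ edgesBelow a t (a + t))

a+t<a+1+t : ∀ a t → a + t < a + suc t
a+t<a+1+t a t = +-monoʳ-< a (n<1+n t)

edgesBelow-lower : ∀ a t j → All (λ e → lower e < a + t) (edgesBelow a t j)
edgesBelow-lower a zero    j = []
edgesBelow-lower a (suc t) j =
  a+t<a+1+t a t ∷ a+t<a+1+t a t ∷
  All.map (λ lt → <-trans lt (a+t<a+1+t a t)) (edgesBelow-lower a t j)

edgesBelow-upper : ∀ a t j → All (λ e → upper e ≡ j) (edgesBelow a t j)
edgesBelow-upper a zero    j = []
edgesBelow-upper a (suc t) j = refl ∷ refl ∷ edgesBelow-upper a t j

edgesBelow-unique : ∀ a t j → Unique (edgesBelow a t j)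
edgesBelow-unique a zero    j = []
edgesBelow-unique a (suc t) j =
  ((λ ()) ∷ older) ∷ older ∷ edgesBelow-unique a t j
  where
  older : ∀ {s} → All ((a + t , j , s) ≢_) (edgesBelow a t j)
  older = All.map (λ lt → ≢-sym (≢-by lower lt)) (edgesBelow-lower a t j)

negLoopAt-diagonal : ∀ j → All (λ e → lower e ≡ j × upper e ≡ j) (negLoopAt j)
negLoopAt-diagonal zero    = []
negLoopAt-diagonal (suc j) = (refl , refl) ∷ []

negLoopAt-unique : ∀ j → Unique (negLoopAt j)
negLoopAt-unique zero    = []
negLoopAt-unique (suc j) = [] ∷ []

newEdges-upper : ∀ a t → All (λ e → upper e ≡ a + t) (negLoopAt (a + t) ++ edgesBelow a t (a + t))
newEdges-upper a t =
  ++⁺ (All.map (λ (_ , eq) → eq) (negLoopAt-diagonal (a + t))) (edgesBelow-upper a t (a + t))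

newEdges-unique : ∀ a t → Unique (negLoopAt (a + t) ++ edgesBelow a t (a + t))
newEdges-unique a t =
  AllPairs.++⁺ (negLoopAt-unique (a + t)) (edgesBelow-unique a t (a + t))
    (All.map (λ (lx≡ , _) → All.map (λ ly< → ≢-sym (≢-by lower (subst (_ <_) (sym lx≡) ly<)))
                                     (edgesBelow-lower a t (a + t)))
             (negLoopAt-diagonal (a + t)))

edgesOn-upper : ∀ a t → All (λ e → upper e < a + t) (edgesOn a t)
edgesOn-upper a zero    = []
edgesOn-upper a (suc t) = ++⁺
  (All.map (λ lt → <-trans lt (a+t<a+1+t a t)) (edgesOn-upper a t))
  (All.map (λ eq → subst (_< a + suc t) (sym eq) (a+t<a+1+t a t)) (newEdges-upper a t))

edgesOn-unique : ∀ a t → Unique (edgesOn a t)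
edgesOn-unique a zero    = []
edgesOn-unique a (suc t) = AllPairs.++⁺ (edgesOn-unique a t) (newEdges-unique a t)
  (All.map (λ {x} ux< → All.map (λ uy≡ → ≢-by upper (subst (upper x <_) (sym uy≡) ux<))
                                (newEdges-upper a t))
           (edgesOn-upper a t))

[1+m]²≡m²+[1+2m] : ∀ m → suc m * suc m ≡ m * m + suc (m + m)
[1+m]²≡m²+[1+2m] = solve-∀

[1+m][3+m]≡m[2+m]+[3+2m] : ∀ m → suc m * (2 + suc m) ≡ m * (2 + m) + suc (suc m + suc m)
[1+m][3+m]≡m[2+m]+[3+2m] = solve-∀

[1+m]²≡1+m[2+m] : ∀ m → suc m * suc m ≡ suc (m * (2 + m))
[1+m]²≡1+m[2+m] = solve-∀

length-edgesBelow : ∀ a t j → length (edgesBelow a t j) ≡ t + t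
length-edgesBelow a zero    j = refl
length-edgesBelow a (suc t) j = cong suc (trans (cong suc (length-edgesBelow a t j)) (sym (+-suc t t)))

length-edgesOn-suc : ∀ a t → length (edgesOn (suc a) t) ≡ t * t
length-edgesOn-suc a zero    = refl
length-edgesOn-suc a (suc t) = begin
  length (edgesOn (suc a) (suc t))
    ≡⟨ length-++ (edgesOn (suc a) t) ⟩
  length (edgesOn (suc a) t) + suc (length (edgesBelow (suc a) t (suc a + t)))
    ≡⟨ cong₂ (λ p q → p + suc q) (length-edgesOn-suc a t) (length-edgesBelow (suc a) t (suc a + t)) ⟩
  t * t + suc (t + t)
    ≡⟨ [1+m]²≡m²+[1+2m] t ⟨
  suc t * suc t ∎
  where open ≡-Reasoning

-- Without the loop at 0.
length-edgesOn-zero : ∀ t → length (edgesOn 0 (suc t)) ≡ t * (2 + t)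
length-edgesOn-zero zero    = refl
length-edgesOn-zero (suc t) = begin
  length (edgesOn 0 (suc (suc t)))
    ≡⟨ length-++ (edgesOn 0 (suc t)) ⟩
  length (edgesOn 0 (suc t)) + suc (length (edgesBelow 0 (suc t) (suc t)))
    ≡⟨ cong₂ (λ p q → p + suc q) (length-edgesOn-zero t) (length-edgesBelow 0 (suc t) (suc t)) ⟩
  t * (2 + t) + suc (suc t + suc t)
    ≡⟨ [1+m][3+m]≡m[2+m]+[3+2m] t ⟨
  suc t * (2 + suc t) ∎
  where open ≡-Reasoning

VMagRange : ℕ → ℕ → ℕ → Set
VMagRange k a t = ∀ i → a ≤ i → i < a + t → VMag k i

VMagRange-init : ∀ {k a t} → VMagRange k a (suc t) → VMagRange k a t
VMagRange-init {a = a} {t} range i a≤i i<a+t = range i a≤i (<-trans i<a+t (a+t<a+1+t a t))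

VMagRange-last : ∀ {k a t} → VMagRange k a (suc t) → VMag k (a + t)
VMagRange-last {a = a} {t} range = range (a + t) (m≤m+n a t) (a+t<a+1+t a t)

module CompleteColouring {G : Graph} {σ : Signature G} {k : ℕ} {φ : Colouring G k}
                         (complete : Complete G σ k φ) where
  open Complete complete

  reduce : Fin (n G) × Fin (n G) → KEdge
  reduce (u , v) = mag (φ u) ⊓ mag (φ v) , mag (φ u) ⊔ mag (φ v) , redSign G σ φ u v

  Reduced : KEdge → Set
  Reduced e = e ∈ map reduce (E G)

  reduced-edge : ∀ i j → VMag k i → VMag k j → i < j → ∀ s → Reduced (i , j , s)
  reduced-edge i j vi vj i<j s with edgesAll i j vi vj i<j s
  ... | u , v , uv∈E , inj₁ (mu , mv) , sg = subst Reduced eq (∈-map⁺ reduce uv∈E)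
    where
    eq : reduce (u , v) ≡ (i , j , s)
    eq rewrite mu | mv | sg | m≤n⇒m⊓n≡m (<⇒≤ i<j) | m≤n⇒m⊔n≡n (<⇒≤ i<j) = refl
  ... | u , v , uv∈E , inj₂ (mu , mv) , sg = subst Reduced eq (∈-map⁺ reduce uv∈E)
    where
    eq : reduce (u , v) ≡ (i , j , s)
    eq rewrite mu | mv | sg | m≥n⇒m⊓n≡n (<⇒≤ i<j) | m≥n⇒m⊔n≡m (<⇒≤ i<j) = refl

  reduced-loop : ∀ i → VMag k i → 1 ≤ i → Reduced (i , i , neg)
  reduced-loop i vi 1≤i with loopsAll i vi 1≤i
  ... | u , v , uv∈E , mu , mv , sg = subst Reduced eq (∈-map⁺ reduce uv∈E)
    where
    eq : reduce (u , v) ≡ (i , i , neg)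
    eq rewrite mu | mv | sg | ⊓-idem i | ⊔-idem i = refl

  negLoopAt-reduced : ∀ j → VMag k j → All Reduced (negLoopAt j)
  negLoopAt-reduced zero    _  = []
  negLoopAt-reduced (suc j) vj = reduced-loop (suc j) vj (s≤s z≤n) ∷ []

  edgesBelow-reduced : ∀ a t j → VMagRange k a t → VMag k j → a + t ≤ j →
                       All Reduced (edgesBelow a t j)
  edgesBelow-reduced a zero    j _     _  _       = []
  edgesBelow-reduced a (suc t) j range vj a+1+t≤j =
    reduced-edge (a + t) j vi vj a+t<j pos ∷ reduced-edge (a + t) j vi vj a+t<j neg ∷
    edgesBelow-reduced a t j (VMagRange-init range) vj (<⇒≤ a+t<j)
    where
    a+t<j : a + t < j
    a+t<j = <-≤-trans (a+t<a+1+t a t) a+1+t≤j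
    vi : VMag k (a + t)
    vi = VMagRange-last range

  edgesOn-reduced : ∀ a t → VMagRange k a t → All Reduced (edgesOn a t)
  edgesOn-reduced a zero    _     = []
  edgesOn-reduced a (suc t) range =
    ++⁺ (edgesOn-reduced a t (VMagRange-init range))
        (++⁺ (negLoopAt-reduced (a + t) (VMagRange-last range))
             (edgesBelow-reduced a t (a + t) (VMagRange-init range) (VMagRange-last range) ≤-refl))

  length-edgesOn≤∣E∣ : ∀ a t → VMagRange k a t → length (edgesOn a t) ≤ ∣E∣ G
  length-edgesOn≤∣E∣ a t range = begin
    length (edgesOn a t)           ≤⟨ Unique-⊆⇒length≤ (edgesOn-unique a t) (All.lookup (edgesOn-reduced a t range)) ⟩
    length (map reduce (E G))      ≡⟨ length-map reduce (E G) ⟩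
    ∣E∣ G                          ∎
    where open ≤-Reasoning

ψ-lt-even : ∀ m (G : Graph) (σ : Signature G) → ∣E∣ G < m * m → ψ-lt G σ (2 * m)
ψ-lt-even m G σ ∣E∣<m² k 2m≤k (S , φ , complete) = <⇒≱ ∣E∣<m² (begin
  m * m                 ≡⟨ length-edgesOn-suc 0 m ⟨
  length (edgesOn 1 m)  ≤⟨ CompleteColouring.length-edgesOn≤∣E∣ complete 1 m range ⟩
  ∣E∣ G                 ∎)
  where
  open ≤-Reasoning
  range : VMagRange k 1 m
  range i 1≤i (s≤s i≤m) = inj₁ (1≤i , ≤-trans (*-monoʳ-≤ 2 i≤m) 2m≤k)

[1+2m]%2≡1 : ∀ m → (1 + 2 * m) % 2 ≡ 1
[1+2m]%2≡1 m = trans (cong (_% 2) (cong suc (*-comm 2 m))) ([m+kn]%n≡m%n 1 m 2)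

ψ-lt-odd : ∀ m (G : Graph) (σ : Signature G) → ∣E∣ G < m * (2 + m) → ψ-lt G σ (1 + 2 * m)
ψ-lt-odd m G σ ∣E∣<m[2+m] k 1+2m≤k (S , φ , complete) with 2 * suc m ≤? k
... | yes 2[1+m]≤k = ψ-lt-even (suc m) G σ ∣E∣<[1+m]² k 2[1+m]≤k (S , φ , complete)
  where
  ∣E∣<[1+m]² : ∣E∣ G < suc m * suc m
  ∣E∣<[1+m]² = <-trans ∣E∣<m[2+m] (≤-reflexive (sym ([1+m]²≡1+m[2+m] m)))
... | no 2[1+m]≰k = <⇒≱ ∣E∣<m[2+m] (begin
  m * (2 + m)                ≡⟨ length-edgesOn-zero m ⟨
  length (edgesOn 0 (suc m))  ≤⟨ CompleteColouring.length-edgesOn≤∣E∣ complete 0 (suc m) range ⟩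
  ∣E∣ G                       ∎)
  where
  open ≤-Reasoning
  k≡1+2m : k ≡ 1 + 2 * m
  k≡1+2m = ≤-antisym (subst (k ≤_) (+-suc m (m + 0)) (≤-pred (≰⇒> 2[1+m]≰k))) 1+2m≤k
  range : VMagRange k 0 (suc m)
  range zero    _ _         = inj₂ (refl , subst (λ k → k % 2 ≡ 1) (sym k≡1+2m) ([1+2m]%2≡1 m))
  range (suc i) _ (s≤s i≤m) = inj₁ (s≤s z≤n , ≤-trans (*-monoʳ-≤ 2 i≤m) (≤-trans (n≤1+n _) 1+2m≤k))

proposition2p9 : (k : ℕ) → 1 ≤ k → (G : Graph) → (σ : Signature G) →
    ((∣E∣ G < k * k ∸ 1 → ψ-lt G σ (2 * k ∸ 1)) × (∣E∣ G < k * k → ψ-lt G σ (2 * k)))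
proposition2p9 (suc m) _ G σ = odd-case , ψ-lt-even (suc m) G σ
  where
  edges≡ : suc m * suc m ∸ 1 ≡ m * (2 + m)
  edges≡ = cong (_∸ 1) ([1+m]²≡1+m[2+m] m)
  colours≡ : 2 * suc m ∸ 1 ≡ 1 + 2 * m
  colours≡ = +-suc m (m + 0)
  odd-case : ∣E∣ G < suc m * suc m ∸ 1 → ψ-lt G σ (2 * suc m ∸ 1)
  odd-case = subst₂ (λ b c → ∣E∣ G < b → ψ-lt G σ c) (sym edges≡) (sym colours≡) (ψ-lt-odd m G σ)
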